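{- Let $\lambda$ be a partition with $l(\lambda)\le n$, $z$ a content with $|z|=|\lambda|$, and $S_1\succ\cdots\succ S_K$ the semistandard tableaux of shape $\lambda$ and content $z$ in row word order. Then for each $i$, in $\mathbb{C}^{F(\lambda,z)}/A(\lambda,z)$, $$S_i=\sum_{j=1}^K R(S_i,S_j)\cdot D(S_j).$$
   Context: Fix $n\ge 2$. A partition $\lambda$ is identified with its Young diagram with column lengths $\zeta_1\ge\cdots\ge\zeta_{\lambda_1}$; $(r,c)$ is the box in row $r$, column $c$. A filling of shape $\lambda$ assigns a value in $\{1,\dots,n\}$ to each box; its content counts occurrences of each value. Semistandard tableau: filling with no repeated values in a column, columns strictly increasing downward and rows weakly increasing. Same row content: row-by-row equality of multisets of entries. $F(\lambda,z)$: fillings of shape $\lambda$ and content $z$. $\mathfrak{S}_\lambda=\prod_c\mathfrak{S}_{\zeta_c}$ acts by $F_{\underline\pi}(r,c)=F(\pi_c(r),c)$, $\mathrm{sgn}(\underline\pi)=\prod_c\mathrm{sgn}(\pi_c)$. $R(F,S)=\sum\mathrm{sgn}(\underline\pi)$ over $\underline\pi\in\mathfrak{S}_\lambda$ with $F_{\underline\pi}$ having the same row content as $S$. $\mathbb{C}^{F(\lambda,z)}\subset\mathbb{C}^{F(n)}$: vector spaces with bases $F(\lambda,z)$ and all fillings with entries in $\{1,\dots,n\}$. $A(n)$ is spanned by (i) $E+F$ with $E,F$ of the same shape and content differing in one column by a transposition, and (ii) $E-\sum F'$ over all $F'$ obtained from $E$ by swapping the top $m$ entries of column $j+1$ with any $m$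 entries of column $j$ (keeping vertical order), some $j,m$. $A(\lambda,z)=A(n)\cap\mathbb{C}^{F(\lambda,z)}$. Row word order: $E\prec F$ iff the row-by-row reading word of $E$ (left to right, top to bottom) lexicographically precedes that of $F$. D-basis: recursively $D(S_i)=S_i-\sum_{j<i}R(S_i,S_j)\,D(S_j)$. -}

module Defs where

open import Data.Bool using (Bool; true; false; if_then_else_; _∧_)
open import Data.Nat as ℕ using (ℕ; zero; suc; _≤_; _<_; _≤?_; _≡ᵇ_; _⊔_)
open import Data.Fin as Fin using (Fin)
open import Data.Integer as ℤ using (ℤ)
open import Data.Rational as ℚ using (ℚ; 0ℚ; 1ℚ)
open import Data.List as List
  using (List; []; _∷_; [_]; _++_; map; foldr; length; filter; concat; concatMap;
         mapMaybe; upTo; take; drop; zipWith)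
import Data.List.Properties as ListP
open import Data.List.Relation.Unary.All using (All)
open import Data.List.Relation.Unary.Linked using (Linked)
open import Data.Maybe using (Maybe; just; nothing)
open import Data.Product using (_×_; _,_; Σ; proj₁; proj₂)
open import Data.Vec as Vec using (Vec)
open import Relation.Binary.PropositionalEquality using (_≡_; _≢_)
open import Relation.Nullary.Decidable using (⌊_⌋; Dec)
open import Data.Nat.ListAction using (sum)

private
  variable
    A : Set

getAt : List A → ℕ → Maybe A
getAt []       _       = nothing
getAt (x ∷ xs) zero    = just x
getAt (x ∷ xs) (suc i) = getAt xs i

updAt : ℕ → (A → A) → List A → List A
updAt _       f []       = []
updAt zero    f (x ∷ xs) = f x ∷ xs
updAt (suc i) f (x ∷ xs) = x ∷ updAt i f xs

setAt : ℕ → A → List A → List A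
setAt i x = updAt i (λ _ → x)

choose : ℕ → List A → List (List A)
choose zero    _        = [ [] ]
choose (suc m) []       = []
choose (suc m) (x ∷ xs) = map (x ∷_) (choose m xs) ++ choose (suc m) xs

IsPartition : List ℕ → Set
IsPartition lam = Linked (λ a b → b ≤ a) lam × All (λ p → 0 < p) lam

size : List ℕ → ℕ
size = sum

headOr0 : List ℕ → ℕ
headOr0 []      = 0
headOr0 (x ∷ _) = x

-- column lengths ζ₁ ≥ ⋯ ≥ ζ_{λ₁} of the Young diagram, ζ_c = #{i : λ_i ≥ c}
conj : List ℕ → List ℕ
conj lam = map (λ c → length (filter (suc c ≤?_) lam)) (upTo (headOr0 lam))

-- Fillings with entries in {1,…,n} (value v+1 is represented by v : Fin n).
-- A filling is stored as its list of columns, each column listed top to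
-- bottom; entry (r,c) (0-based) is the r-th entry of the c-th column.

Filling : ℕ → Set
Filling n = List (List (Fin n))

-- the shape of a filling is a partition: nonempty columns of weakly
-- decreasing length (these are the fillings indexing the basis of ℂ^{F(n)})
PartShape : ∀ {n} → Filling n → Set
PartShape F = Linked (λ a b → b ≤ a) (map length F) × All (λ p → 0 < p) (map length F)

col : ∀ {n} → Filling n → ℕ → List (Fin n)
col F c with getAt F c
... | just x  = x
... | nothing = []

row : ∀ {n} → ℕ → Filling n → List (Fin n)
row r F = mapMaybe (λ cl → getAt cl r) F

height : ∀ {n} → Filling n → ℕ
height F = foldr _⊔_ 0 (map length F)

count : ∀ {n} → Fin n → List (Fin n) → ℕ
count v xs = length (filter (v Fin.≟_) xs)

content : ∀ {n} → Filling n → Vec ℕ n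
content F = Vec.tabulate (λ v → count v (concat F))

InF : ∀ {n} → List ℕ → Vec ℕ n → Filling n → Set
InF lam z F = map length F ≡ conj lam × content F ≡ z

SSYT : ∀ {n} → List ℕ → Vec ℕ n → Filling n → Set
SSYT lam z F =
  InF lam z F × All (Linked Fin._<_) F × (∀ r → Linked Fin._≤_ (row r F))

allB : (A → Bool) → List A → Bool
allB p = foldr (λ x b → p x ∧ b) true

sameRowContent : ∀ {n} → Filling n → Filling n → Bool
sameRowContent {n} F S =
  allB (λ r → allB (λ v → count v (row r F) ≡ᵇ count v (row r S)) (List.allFin n))
      (upTo (height F ⊔ height S))

rowWord : ∀ {n} → Filling n → List (Fin n)
rowWord F = concatMap (λ r → row r F) (upTo (height F))

data _<Lex_ {n : ℕ} : List (Fin n) → List (Fin n) → Set where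
  []<∷  : ∀ {y ys} → [] <Lex (y ∷ ys)
  here  : ∀ {x y xs ys} → x Fin.< y → (x ∷ xs) <Lex (y ∷ ys)
  there : ∀ {x xs ys} → xs <Lex ys → (x ∷ xs) <Lex (x ∷ ys)

_≺_ : ∀ {n} → Filling n → Filling n → Set
E ≺ F = rowWord E <Lex rowWord F

insertions : A → List A → List (ℤ × List A)
insertions x []       = [ (ℤ.+ 1 , [ x ]) ]
insertions x (y ∷ ys) =
  (ℤ.+ 1 , x ∷ y ∷ ys) ∷ map (λ p → (ℤ.- proj₁ p , y ∷ proj₂ p)) (insertions x ys)

perms : List A → List (ℤ × List A)
perms []       = [ (ℤ.+ 1 , []) ]
perms (x ∷ xs) =
  concatMap (λ p → map (λ q → (proj₁ p ℤ.* proj₁ q , proj₂ q)) (insertions x (proj₂ p)))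
            (perms xs)

-- all F_π for π ∈ 𝔖_λ, each with sgn(π)
colPerms : ∀ {n} → Filling n → List (ℤ × Filling n)
colPerms []       = [ (ℤ.+ 1 , []) ]
colPerms (c ∷ cs) =
  concatMap (λ p → map (λ q → (proj₁ p ℤ.* proj₁ q , proj₂ p ∷ proj₂ q)) (colPerms cs))
            (perms c)

sumℤ : List ℤ → ℤ
sumℤ = foldr ℤ._+_ (ℤ.+ 0)

R : ∀ {n} → Filling n → Filling n → ℤ
R F S = sumℤ (map proj₁ (filter (λ p → sameRowContent (proj₂ p) S Data.Bool.≟ true) (colPerms F)))

-- The vector space ℚ^{F(n)} (finitely supported in all uses), as functions

Vect : ℕ → Set
Vect n = Filling n → ℚ

fromℤ : ℤ → ℚ
fromℤ k = k ℚ./ 1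

_≟F_ : ∀ {n} (E F : Filling n) → Dec (E ≡ F)
_≟F_ = ListP.≡-dec (ListP.≡-dec Fin._≟_)

δ : ∀ {n} → Filling n → Vect n
δ E G = if ⌊ G ≟F E ⌋ then 1ℚ else 0ℚ

_+v_ : ∀ {n} → Vect n → Vect n → Vect n
(u +v v) G = u G ℚ.+ v G

_-v_ : ∀ {n} → Vect n → Vect n → Vect n
(u -v v) G = u G ℚ.- v G

_·v_ : ∀ {n} → ℚ → Vect n → Vect n
(q ·v v) G = q ℚ.* v G

0v : ∀ {n} → Vect n
0v _ = 0ℚ

sumV : ∀ {n} → List (Vect n) → Vect n
sumV = foldr _+v_ 0v

swapIn : ∀ {n} → Filling n → ℕ → ℕ → ℕ → Filling n
swapIn F c a b = updAt c sw F
  where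
  sw : ∀ {n} → List (Fin n) → List (Fin n)
  sw cl with getAt cl a | getAt cl b
  ... | just x | just y = setAt b x (setAt a y cl)
  ... | _      | _      = cl

-- swap the top m entries of column j+1 with the entries of column j in
-- the (increasing) row positions P, keeping vertical order
garnirSwap : ∀ {n} → Filling n → ℕ → ℕ → List ℕ → Filling n
garnirSwap F j m P = setAt j newj (setAt (suc j) newj1 F)
  where
  cj    = col F j
  cj1   = col F (suc j)
  newj  = foldr (λ px l → setAt (proj₁ px) (proj₂ px) l) cj (zipWith _,_ P (take m cj1))
  newj1 = mapMaybe (getAt cj) P ++ drop m cj1

data IsGen {n : ℕ} : Vect n → Set where
  transp : (E : Filling n) → PartShape E → (c a b : ℕ) →
           c < length E → a < length (col E c) → b < length (col E c) → a ≢ b →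
           IsGen (δ E +v δ (swapIn E c a b))
  garnir : (E : Filling n) → PartShape E → (j m : ℕ) →
           suc j < length E → 1 ≤ m → m ≤ length (col E (suc j)) →
           IsGen (δ E -v sumV (map (λ P → δ (garnirSwap E j m P))
                                  (choose m (upTo (length (col E j))))))

InA : ∀ {n} → Vect n → Set
InA {n} v = Σ (List (ℚ × Vect n)) λ gs →
  All (λ g → IsGen (proj₂ g)) gs ×
  (∀ G → v G ≡ foldr ℚ._+_ 0ℚ (map (λ g → proj₁ g ℚ.* proj₂ g G) gs))

SupportedIn : ∀ {n} → List ℕ → Vec ℕ n → Vect n → Set
SupportedIn lam z v = ∀ G → v G ≢ 0ℚ → InF lam z G

InAλz : ∀ {n} → List ℕ → Vec ℕ n → Vect n → Set
InAλz lam z v = InA v × SupportedIn lam z v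

-- D-basis: for S₁ ≻ ⋯ ≻ S_K,  D(S_i) = S_i − Σ_{j<i} R(S_i,S_j) D(S_j)

Dgo : ∀ {n} → List (Filling n × Vect n) → List (Filling n) → List (Vect n)
Dgo acc []       = []
Dgo acc (S ∷ Ss) = d ∷ Dgo (acc ++ [ (S , d) ]) Ss
  where
  d = δ S -v sumV (map (λ p → fromℤ (R S (proj₁ p)) ·v proj₂ p) acc)

Dlist : ∀ {n} → List (Filling n) → List (Vect n)
Dlist = Dgo []

-- The vector S_i − Σ_j R(S_i,S_j) D(S_j) is in fact zero.  The content
-- is that R is unitriangular on semistandard tableaux of a fixed shape: if a column rearrangement F
-- of S has the row contents of T, then row by row the top row of T, being the sorted top row of F,
-- dominates that of S, so S ⪯ T in row word order, with equality only for F = S.  Hence R(S,S) = 1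
-- (the columns of S have distinct entries, so only the identity fixes S) and R(S,T) = 0 for T ≺ S,
-- and the recursion defining D telescopes:
--   Σ_j R(S_i,S_j) D(S_j) = Σ_{j<i} R(S_i,S_j) D(S_j) + D(S_i) = S_i.
module Submission where

open import Defs
open import Data.Bool as Bool using (Bool; true; false; T; if_then_else_; _∧_)
open import Data.Bool.Properties using (T-∧; T-≡)
open import Data.Empty using (⊥-elim)
open import Data.Fin as Fin using (Fin; toℕ)
import Data.Fin.Properties as Fin
open import Data.Integer as ℤ using (ℤ; _+_; _*_; -_)
import Data.Integer.Properties as ℤ
open import Data.List
  using ( List; []; _∷_; _++_; [_]; map; foldr; filter; length; lookup; zipWith; drop
        ; concatMap; applyUpTo; upTo; allFin)
import Data.List.Properties as List
open import Data.List.Membership.Propositional using (_∈_; _∉_)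
open import Data.List.Membership.Propositional.Properties using (∈-∃++; ∈-lookup; ∈-upTo⁺; ∈-allFin)
open import Data.List.Relation.Binary.Permutation.Propositional as Perm using (_↭_; ↭-sym; ↭-trans)
import Data.List.Relation.Binary.Permutation.Propositional.Properties as Perm
open import Data.List.Relation.Binary.Pointwise using (Pointwise; []; _∷_)
open import Data.List.Relation.Binary.Pointwise.Properties using (Pointwise-length)
open import Data.List.Relation.Unary.All as All using (All; []; _∷_)
import Data.List.Relation.Unary.All.Properties as All
open import Data.List.Relation.Unary.AllPairs as AllPairs using (AllPairs; _∷_)
open import Data.List.Relation.Unary.Any using (here; there)
open import Data.List.Relation.Unary.Linked as Linked using (Linked; [])
import Data.List.Relation.Unary.Linked.Properties as Linkedₚ
open import Data.List.Relation.Unary.Unique.Propositional using (Unique)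
open import Data.Maybe using (nothing)
open import Data.Nat as ℕ using (ℕ; zero; suc; z≤n; s≤s; _≤_; _⊔_)
import Data.Nat.Properties as ℕ
open import Data.Nat.ListAction using (sum)
open import Data.Nat.ListAction.Properties using (sum-↭)
open import Data.Product using (_×_; _,_; proj₁; proj₂)
open import Data.Rational as ℚ using (0ℚ; 1ℚ)
import Data.Rational.Properties as ℚ
open import Data.Rational.Solver using (module +-*-Solver)
open import Data.Sum using (_⊎_; inj₁; inj₂)
open import Data.Unit using (tt)
open import Data.Vec using (Vec)
import Data.Vec
open import Function using (id; _∘_; Equivalence)
open import Relation.Binary.Definitions using (DecidableEquality)
open import Relation.Binary.PropositionalEquality hiding ([_])
open import Relation.Nullary using (¬_; Dec; yes; no; does)
open import Relation.Nullary.Decidable using (dec-true; dec-false)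
open import Relation.Unary using (Decidable)

open import Algebra.Properties.CommutativeSemigroup ℕ.+-commutativeSemigroup using (x∙yz≈y∙xz)

private variable A B : Set

sumOf : (A → ℤ) → List A → ℤ
sumOf w xs = sumℤ (map w xs)

sumOf-++ : (w : A → ℤ) (xs ys : List A) → sumOf w (xs ++ ys) ≡ sumOf w xs + sumOf w ys
sumOf-++ w []       ys = sym (ℤ.+-identityˡ _)
sumOf-++ w (x ∷ xs) ys = trans (cong (w x +_) (sumOf-++ w xs ys)) (sym (ℤ.+-assoc (w x) _ _))

sumOf-concatMap : (w : B → ℤ) (f : A → List B) (xs : List A) →
                  sumOf w (concatMap f xs) ≡ sumOf (sumOf w ∘ f) xs
sumOf-concatMap w f []       = refl
sumOf-concatMap w f (x ∷ xs) =
  trans (sumOf-++ w (f x) (concatMap f xs)) (cong (sumOf w (f x) +_) (sumOf-concatMap w f xs))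

sumOf-map : (w : B → ℤ) (f : A → B) (xs : List A) → sumOf w (map f xs) ≡ sumOf (w ∘ f) xs
sumOf-map w f []       = refl
sumOf-map w f (x ∷ xs) = cong (w (f x) +_) (sumOf-map w f xs)

sumOf-cong : {P : A → Set} {v w : A → ℤ} {xs : List A} →
             (∀ {x} → P x → v x ≡ w x) → All P xs → sumOf v xs ≡ sumOf w xs
sumOf-cong v≗w []         = refl
sumOf-cong v≗w (px ∷ pxs) = cong₂ _+_ (v≗w px) (sumOf-cong v≗w pxs)

sumOf-cong′ : {v w : A → ℤ} (xs : List A) → (∀ x → v x ≡ w x) → sumOf v xs ≡ sumOf w xs
sumOf-cong′ xs v≗w = cong sumℤ (List.map-cong v≗w xs)

sumOf-zero : {w : A → ℤ} (xs : List A) → (∀ x → w x ≡ ℤ.+ 0) → sumOf w xs ≡ ℤ.+ 0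
sumOf-zero []       w≗0 = refl
sumOf-zero (x ∷ xs) w≗0 = cong₂ _+_ (w≗0 x) (sumOf-zero xs w≗0)

sumOf-*ˡ : (k : ℤ) (w : A → ℤ) (xs : List A) → sumOf (λ x → k * w x) xs ≡ k * sumOf w xs
sumOf-*ˡ k w []       = sym (ℤ.*-zeroʳ k)
sumOf-*ˡ k w (x ∷ xs) = trans (cong (k * w x +_) (sumOf-*ˡ k w xs)) (sym (ℤ.*-distribˡ-+ k (w x) _))

sumOf-*ʳ : (k : ℤ) (w : A → ℤ) (xs : List A) → sumOf (λ x → w x * k) xs ≡ sumOf w xs * k
sumOf-*ʳ k w []       = sym (ℤ.*-zeroˡ k)
sumOf-*ʳ k w (x ∷ xs) = trans (cong (w x * k +_) (sumOf-*ʳ k w xs)) (sym (ℤ.*-distribʳ-+ k (w x) _))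

select : Bool → ℤ → ℤ
select b k = if b then k else ℤ.+ 0

select-*ʳ : (b : Bool) (k m : ℤ) → select b (k * m) ≡ k * select b m
select-*ʳ true  k m = refl
select-*ʳ false k m = sym (ℤ.*-zeroʳ k)

select-∧-* : (b c : Bool) (k m : ℤ) → select (b ∧ c) (k * m) ≡ select b k * select c m
select-∧-* true  c     k m = select-*ʳ c k m
select-∧-* false c     k m = sym (ℤ.*-zeroˡ (select c m))

*-select-1 : (b : Bool) (k : ℤ) → k * select b (ℤ.+ 1) ≡ select b k
*-select-1 true  k = ℤ.*-identityʳ k
*-select-1 false k = ℤ.*-zeroʳ k

sumℤ-filter : {P : ℤ × A → Set} (P? : Decidable P) (xs : List (ℤ × A)) →
              sumℤ (map proj₁ (filter P? xs)) ≡ sumOf (λ p → select (does (P? p)) (proj₁ p)) xs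
sumℤ-filter P? []       = refl
sumℤ-filter P? ((k , a) ∷ xs) with does (P? (k , a))
... | true  = cong (k +_) (sumℤ-filter P? xs)
... | false = trans (sumℤ-filter P? xs) (sym (ℤ.+-identityˡ _))

insertions-↭ : (x : A) (ys : List A) → All (λ p → proj₂ p ↭ x ∷ ys) (insertions x ys)
insertions-↭ x []       = Perm.refl ∷ []
insertions-↭ x (y ∷ ys) =
  Perm.refl ∷ All.map⁺ (All.map (λ p↭ → ↭-trans (Perm.prep y p↭) (Perm.swap y x Perm.refl))
                                (insertions-↭ x ys))

perms-↭ : (xs : List A) → All (λ p → proj₂ p ↭ xs) (perms xs)
perms-↭ []       = Perm.refl ∷ []
perms-↭ (x ∷ xs) =
  All.concat⁺ (All.map⁺ (All.map (λ {p} p↭ →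
    All.map⁺ (All.map (λ q↭ → ↭-trans q↭ (Perm.prep x p↭)) (insertions-↭ x (proj₂ p)))) (perms-↭ xs)))

colPerms-↭ : ∀ {n} (S : Filling n) → All (λ p → Pointwise _↭_ (proj₂ p) S) (colPerms S)
colPerms-↭ []       = [] ∷ []
colPerms-↭ (c ∷ cs) =
  All.concat⁺ (All.map⁺ (All.map (λ c↭ → All.map⁺ (All.map (c↭ ∷_) (colPerms-↭ cs))) (perms-↭ c)))

multiplicity : DecidableEquality B → List (ℤ × B) → B → ℤ
multiplicity _≟_ ps b = sumOf (λ p → select (does (proj₂ p ≟ b)) (proj₁ p)) ps

module _ (_≟_ : DecidableEquality A) where
  private
    _≟ₗ_ : DecidableEquality (List A)
    _≟ₗ_ = List.≡-dec _≟_

  multiplicity-insertions : (x : A) (xs ys : List A) → x ∉ ys →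
    multiplicity _≟ₗ_ (insertions x ys) (x ∷ xs) ≡ select (does (ys ≟ₗ xs)) (ℤ.+ 1)
  multiplicity-insertions x xs []       _   rewrite dec-true (x ≟ x) refl = ℤ.+-identityʳ _
  multiplicity-insertions x xs (y ∷ ys) x∉ rewrite dec-true (x ≟ x) refl =
    trans (cong (select (does ((y ∷ ys) ≟ₗ xs)) (ℤ.+ 1) +_) later) (ℤ.+-identityʳ _)
    where
    y≢x : ¬ y ≡ x
    y≢x y≡x = x∉ (here (sym y≡x))
    later : multiplicity _≟ₗ_ (map (λ p → (- proj₁ p , y ∷ proj₂ p)) (insertions x ys)) (x ∷ xs) ≡ ℤ.+ 0
    later = trans (sumOf-map _ _ (insertions x ys)) (sumOf-zero (insertions x ys) λ p →
              cong (λ b → select (b ∧ does (proj₂ p ≟ₗ xs)) (- proj₁ p)) (dec-false (y ≟ x) y≢x))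

  multiplicity-perms : (xs : List A) → Unique xs → multiplicity _≟ₗ_ (perms xs) xs ≡ ℤ.+ 1
  multiplicity-perms []       _               = refl
  multiplicity-perms (x ∷ xs) (x∉xs ∷ uniq) = begin
      sumOf w (concatMap f (perms xs))
    ≡⟨ sumOf-concatMap w f (perms xs) ⟩
      sumOf (sumOf w ∘ f) (perms xs)
    ≡⟨ sumOf-cong inserted (perms-↭ xs) ⟩
      multiplicity _≟ₗ_ (perms xs) xs
    ≡⟨ multiplicity-perms xs uniq ⟩
      ℤ.+ 1 ∎
    where
    open ≡-Reasoning
    w : ℤ × List A → ℤ
    w q = select (does (proj₂ q ≟ₗ (x ∷ xs))) (proj₁ q)
    f : ℤ × List A → List (ℤ × List A)
    f p = map (λ q → (proj₁ p * proj₁ q , proj₂ q)) (insertions x (proj₂ p))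
    inserted : {p : ℤ × List A} → proj₂ p ↭ xs → sumOf w (f p) ≡ select (does (proj₂ p ≟ₗ xs)) (proj₁ p)
    inserted {ε , ys} ys↭xs = begin
        sumOf w (f (ε , ys))
      ≡⟨ sumOf-map w _ (insertions x ys) ⟩
        sumOf (λ q → select (does (proj₂ q ≟ₗ (x ∷ xs))) (ε * proj₁ q)) (insertions x ys)
      ≡⟨ sumOf-cong′ (insertions x ys) (λ q → select-*ʳ _ ε (proj₁ q)) ⟩
        sumOf (λ q → ε * w q) (insertions x ys)
      ≡⟨ sumOf-*ˡ ε w (insertions x ys) ⟩
        ε * multiplicity _≟ₗ_ (insertions x ys) (x ∷ xs)
      ≡⟨ cong (ε *_) (multiplicity-insertions x xs ys x∉ys) ⟩
        ε * select (does (ys ≟ₗ xs)) (ℤ.+ 1)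
      ≡⟨ *-select-1 _ ε ⟩
        select (does (ys ≟ₗ xs)) ε ∎
      where
      x∉ys : x ∉ ys
      x∉ys x∈ys = All.All¬⇒¬Any x∉xs (Perm.∈-resp-↭ ys↭xs x∈ys)

multiplicity-colPerms : ∀ {n} (S : Filling n) → All Unique S → multiplicity _≟F_ (colPerms S) S ≡ ℤ.+ 1
multiplicity-colPerms []       _            = refl
multiplicity-colPerms {n} (c ∷ cs) (uc ∷ ucs) = begin
    sumOf w (concatMap f (perms c))
  ≡⟨ sumOf-concatMap w f (perms c) ⟩
    sumOf (sumOf w ∘ f) (perms c)
  ≡⟨ sumOf-cong′ (perms c) split ⟩
    sumOf (λ p → wc p * K) (perms c)
  ≡⟨ sumOf-*ʳ K wc (perms c) ⟩
    multiplicity _≟c_ (perms c) c * K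
  ≡⟨ cong₂ _*_ (multiplicity-perms Fin._≟_ c uc) (multiplicity-colPerms cs ucs) ⟩
    ℤ.+ 1 ∎
  where
  open ≡-Reasoning
  _≟c_ : DecidableEquality (List (Fin n))
  _≟c_ = List.≡-dec Fin._≟_
  w : ℤ × Filling n → ℤ
  w q = select (does (proj₂ q ≟F (c ∷ cs))) (proj₁ q)
  f : ℤ × List (Fin n) → List (ℤ × Filling n)
  f p = map (λ q → (proj₁ p * proj₁ q , proj₂ p ∷ proj₂ q)) (colPerms cs)
  wc : ℤ × List (Fin n) → ℤ
  wc p = select (does (proj₂ p ≟c c)) (proj₁ p)
  wcs : ℤ × Filling n → ℤ
  wcs q = select (does (proj₂ q ≟F cs)) (proj₁ q)
  K : ℤ
  K = multiplicity _≟F_ (colPerms cs) cs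
  -- does (List.≡-dec _ (x ∷ xs) (y ∷ ys)) reduces to the conjunction of the componentwise tests.
  split : (p : ℤ × List (Fin n)) → sumOf w (f p) ≡ wc p * K
  split (ε , d) = begin
      sumOf w (f (ε , d))
    ≡⟨ sumOf-map w _ (colPerms cs) ⟩
      sumOf (λ q → select (does (d ≟c c) ∧ does (proj₂ q ≟F cs)) (ε * proj₁ q)) (colPerms cs)
    ≡⟨ sumOf-cong′ (colPerms cs) (λ q → select-∧-* (does (d ≟c c)) (does (proj₂ q ≟F cs)) ε (proj₁ q)) ⟩
      sumOf (λ q → wc (ε , d) * wcs q) (colPerms cs)
    ≡⟨ sumOf-*ˡ (wc (ε , d)) wcs (colPerms cs) ⟩
      wc (ε , d) * K ∎

module _ {n : ℕ} where

  indicator : Fin n → Fin n → ℕ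
  indicator v x = if does (v Fin.≟ x) then 1 else 0

  count-∷ : (v x : Fin n) (xs : List (Fin n)) → count v (x ∷ xs) ≡ indicator v x ℕ.+ count v xs
  count-∷ v x xs with does (v Fin.≟ x)
  ... | true  = refl
  ... | false = refl

  count-prep : (v x : Fin n) {xs ys : List (Fin n)} →
               count v xs ≡ count v ys → count v (x ∷ xs) ≡ count v (x ∷ ys)
  count-prep v x e with does (v Fin.≟ x)
  ... | true  = cong suc e
  ... | false = e

  count-∷-injective : (v x : Fin n) {xs ys : List (Fin n)} →
                      count v (x ∷ xs) ≡ count v (x ∷ ys) → count v xs ≡ count v ys
  count-∷-injective v x e with does (v Fin.≟ x)
  ... | true  = ℕ.suc-injective e
  ... | false = e

  count-swap : (v x y : Fin n) (xs : List (Fin n)) → count v (x ∷ y ∷ xs) ≡ count v (y ∷ x ∷ xs)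
  count-swap v x y xs = begin
      count v (x ∷ y ∷ xs)                             ≡⟨ count-∷ v x (y ∷ xs) ⟩
      indicator v x ℕ.+ count v (y ∷ xs)              ≡⟨ cong (indicator v x ℕ.+_) (count-∷ v y xs) ⟩
      indicator v x ℕ.+ (indicator v y ℕ.+ count v xs) ≡⟨ x∙yz≈y∙xz (indicator v x) (indicator v y) _ ⟩
      indicator v y ℕ.+ (indicator v x ℕ.+ count v xs) ≡⟨ cong (indicator v y ℕ.+_) (count-∷ v x xs) ⟨
      indicator v y ℕ.+ count v (x ∷ xs)              ≡⟨ count-∷ v y (x ∷ xs) ⟨
      count v (y ∷ x ∷ xs)                             ∎
    where open ≡-Reasoning

  count-↭ : (v : Fin n) {xs ys : List (Fin n)} → xs ↭ ys → count v xs ≡ count v ys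
  count-↭ v Perm.refl        = refl
  count-↭ v (Perm.prep x p)  = count-prep v x (count-↭ v p)
  count-↭ v (Perm.swap x y p) = trans (count-prep v x (count-prep v y (count-↭ v p))) (count-swap v x y _)
  count-↭ v (Perm.trans p q) = trans (count-↭ v p) (count-↭ v q)

  count-∷-self : (x : Fin n) (xs : List (Fin n)) → count x (x ∷ xs) ≡ suc (count x xs)
  count-∷-self x xs rewrite dec-true (x Fin.≟ x) refl = refl

  0<count⇒∈ : (v : Fin n) (xs : List (Fin n)) → 0 ℕ.< count v xs → v ∈ xs
  0<count⇒∈ v (x ∷ xs) 0<c with v Fin.≟ x
  ... | yes refl = here refl
  ... | no _     = there (0<count⇒∈ v xs 0<c)

  ≡count⇒↭ : (xs ys : List (Fin n)) → (∀ v → count v xs ≡ count v ys) → xs ↭ ys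
  ≡count⇒↭ []       []       _     = Perm.refl
  ≡count⇒↭ []       (y ∷ ys) equal with () ← trans (equal y) (count-∷-self y ys)
  ≡count⇒↭ (x ∷ xs) ys       equal
    with ys₁ , ys₂ , refl ← ∈-∃++ (0<count⇒∈ x ys (subst (0 ℕ.<_) (trans (sym (count-∷-self x xs)) (equal x))
                                                        (s≤s z≤n)))
    = ↭-trans (Perm.prep x (≡count⇒↭ xs (ys₁ ++ ys₂) rest)) (↭-sym (Perm.shift x ys₁ ys₂))
    where
    rest : ∀ v → count v xs ≡ count v (ys₁ ++ ys₂)
    rest v = count-∷-injective v x (trans (equal v) (count-↭ v (Perm.shift x ys₁ ys₂)))

  All-≤-Pointwise : {a : Fin n} {xs ys : List (Fin n)} →
                    All (a Fin.≤_) xs → Pointwise Fin._≤_ xs ys → All (a Fin.≤_) ys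
  All-≤-Pointwise []           []           = []
  All-≤-Pointwise (a≤x ∷ a≤xs) (x≤y ∷ xs≤ys) = Fin.≤-trans a≤x x≤y ∷ All-≤-Pointwise a≤xs xs≤ys

  Pointwise-≤-raise : {c d : Fin n} {xs : List (Fin n)} (ys₁ ys₂ : List (Fin n)) →
                      Pointwise Fin._≤_ xs (ys₁ ++ c ∷ ys₂) → c Fin.≤ d →
                      Pointwise Fin._≤_ xs (ys₁ ++ d ∷ ys₂)
  Pointwise-≤-raise []        ys₂ (x≤c ∷ xs≤ys) c≤d = Fin.≤-trans x≤c c≤d ∷ xs≤ys
  Pointwise-≤-raise (y ∷ ys₁) ys₂ (x≤y ∷ xs≤ys) c≤d = x≤y ∷ Pointwise-≤-raise ys₁ ys₂ xs≤ys c≤d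

  head≤all : {a : Fin n} {xs : List (Fin n)} → Linked Fin._≤_ (a ∷ xs) → All (a Fin.≤_) (a ∷ xs)
  head≤all = Linkedₚ.Linked⇒All Fin.≤-trans Fin.≤-refl

  -- The head c of zs is the least entry of ys; moving the head of ys into the slot of c keeps ys
  -- above xs, so the claim reduces to the tails.
  Pointwise-≤-sort : {xs ys zs : List (Fin n)} → Linked Fin._≤_ xs → Linked Fin._≤_ zs →
                     Pointwise Fin._≤_ xs ys → ys ↭ zs → Pointwise Fin._≤_ xs zs
  Pointwise-≤-sort _ _ [] []↭zs rewrite Perm.↭-empty-inv (↭-sym []↭zs) = []
  Pointwise-≤-sort {zs = []} _ _ (_ ∷ _) ys↭[] = ⊥-elim (Perm.¬x∷xs↭[] ys↭[])
  Pointwise-≤-sort {a ∷ xs} {b ∷ ys} {c ∷ zs} xs↑ zs↑ (a≤b ∷ xs≤ys) ys↭zs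
    with ∈-∃++ (Perm.∈-resp-↭ (↭-sym ys↭zs) (here refl))
  ... | [] , ys₂ , refl =
    a≤c ∷ Pointwise-≤-sort (Linked.tail xs↑) (Linked.tail zs↑) xs≤ys (Perm.drop-∷ ys↭zs)
    where a≤c = Fin.≤-trans (All.head (head≤all xs↑)) a≤b
  ... | d ∷ ys₁ , ys₂ , refl =
    a≤c ∷ Pointwise-≤-sort (Linked.tail xs↑) (Linked.tail zs↑) (Pointwise-≤-raise ys₁ ys₂ xs≤ys c≤d) ys′↭zs
    where
    a≤c : a Fin.≤ c
    a≤c = All.lookup (All-≤-Pointwise (head≤all xs↑) (a≤b ∷ xs≤ys)) (Perm.∈-resp-↭ (↭-sym ys↭zs) (here refl))
    c≤d : c Fin.≤ d
    c≤d = All.lookup (head≤all zs↑) (Perm.∈-resp-↭ ys↭zs (here refl))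
    ys′↭zs : ys₁ ++ d ∷ ys₂ ↭ zs
    ys′↭zs = ↭-trans (Perm.shift d ys₁ ys₂) (↭-sym (Perm.drop-mid [] (d ∷ ys₁) (↭-sym ys↭zs)))

  Pointwise-≤⇒≡⊎<Lex : {xs ys : List (Fin n)} → Pointwise Fin._≤_ xs ys → xs ≡ ys ⊎ xs <Lex ys
  Pointwise-≤⇒≡⊎<Lex [] = inj₁ refl
  Pointwise-≤⇒≡⊎<Lex {x ∷ _} {y ∷ _} (x≤y ∷ xs≤ys) with x Fin.≟ y | Pointwise-≤⇒≡⊎<Lex xs≤ys
  ... | no x≢y   | _          = inj₂ (here (Fin.≤∧≢⇒< x≤y x≢y))
  ... | yes refl | inj₁ refl  = inj₁ refl
  ... | yes refl | inj₂ xs<ys = inj₂ (there xs<ys)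

  private
    weight : List (Fin n) → ℕ
    weight xs = sum (map Fin.toℕ xs)

    Pointwise-≤-weight : {xs ys : List (Fin n)} → Pointwise Fin._≤_ xs ys → weight xs ℕ.≤ weight ys
    Pointwise-≤-weight []            = z≤n
    Pointwise-≤-weight (x≤y ∷ xs≤ys) = ℕ.+-mono-≤ x≤y (Pointwise-≤-weight xs≤ys)

    Pointwise-≤-weight-≡ : {xs ys : List (Fin n)} → Pointwise Fin._≤_ xs ys → weight xs ≡ weight ys → xs ≡ ys
    Pointwise-≤-weight-≡ [] _ = refl
    Pointwise-≤-weight-≡ {x ∷ _} {y ∷ _} (x≤y ∷ xs≤ys) eq with x Fin.≟ y
    ... | no x≢y   = ⊥-elim (ℕ.<-irrefl eq (ℕ.+-mono-<-≤ (Fin.≤∧≢⇒< x≤y x≢y) (Pointwise-≤-weight xs≤ys)))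
    ... | yes refl = cong (x ∷_) (Pointwise-≤-weight-≡ xs≤ys (ℕ.+-cancelˡ-≡ (Fin.toℕ x) _ _ eq))

  -- Compare entry sums.
  Pointwise-≤-↭⇒≡ : {xs ys : List (Fin n)} → Pointwise Fin._≤_ xs ys → ys ↭ xs → xs ≡ ys
  Pointwise-≤-↭⇒≡ xs≤ys ys↭xs = Pointwise-≤-weight-≡ xs≤ys (sym (sum-↭ (Perm.map⁺ Fin.toℕ ys↭xs)))

  <Lex-irrefl : {xs : List (Fin n)} → ¬ xs <Lex xs
  <Lex-irrefl (here x<x)   = Fin.<-irrefl refl x<x
  <Lex-irrefl (there xs<xs) = <Lex-irrefl xs<xs

  <Lex-asym : {xs ys : List (Fin n)} → xs <Lex ys → ¬ ys <Lex xs
  <Lex-asym (here x<y)    (here y<x)    = Fin.<-asym x<y y<x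
  <Lex-asym (here x<x)    (there _)     = Fin.<-irrefl refl x<x
  <Lex-asym (there _)     (here x<x)    = Fin.<-irrefl refl x<x
  <Lex-asym (there xs<ys) (there ys<xs) = <Lex-asym xs<ys ys<xs

  <Lex-trans : {xs ys zs : List (Fin n)} → xs <Lex ys → ys <Lex zs → xs <Lex zs
  <Lex-trans []<∷          (here _)      = []<∷
  <Lex-trans []<∷          (there _)     = []<∷
  <Lex-trans (here x<y)    (here y<z)    = here (Fin.<-trans x<y y<z)
  <Lex-trans (here x<y)    (there _)     = here x<y
  <Lex-trans (there _)     (here y<z)    = here y<z
  <Lex-trans (there xs<ys) (there ys<zs) = there (<Lex-trans xs<ys ys<zs)

  <Lex-++ : {xs ys : List (Fin n)} (us vs : List (Fin n)) →
            length xs ≡ length ys → xs <Lex ys → (xs ++ us) <Lex (ys ++ vs)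
  <Lex-++ us vs _  (here x<y)    = here x<y
  <Lex-++ us vs eq (there xs<ys) = there (<Lex-++ us vs (ℕ.suc-injective eq) xs<ys)

  <Lex-prefix : (ws : List (Fin n)) {xs ys : List (Fin n)} → xs <Lex ys → (ws ++ xs) <Lex (ws ++ ys)
  <Lex-prefix []       xs<ys = xs<ys
  <Lex-prefix (w ∷ ws) xs<ys = there (<Lex-prefix ws xs<ys)

allB-sound : (p : A → Bool) {xs : List A} → T (allB p xs) → ∀ {x} → x ∈ xs → T (p x)
allB-sound p t (here refl) = proj₁ (Equivalence.to T-∧ t)
allB-sound p t (there x∈)  = allB-sound p (proj₂ (Equivalence.to T-∧ t)) x∈

allB-complete : (p : A → Bool) (xs : List A) → (∀ x → T (p x)) → T (allB p xs)
allB-complete p []       _ = tt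
allB-complete p (x ∷ xs) h = Equivalence.from T-∧ (h x , allB-complete p xs h)

module _ {n : ℕ} where

  dropTopRow : Filling n → Filling n
  dropTopRow = map (drop 1)

  row-dropTopRow : (r : ℕ) (F : Filling n) → row r (dropTopRow F) ≡ row (suc r) F
  row-dropTopRow r []           = refl
  row-dropTopRow r ([] ∷ F)     = row-dropTopRow r F
  row-dropTopRow r ((_ ∷ _) ∷ F) rewrite row-dropTopRow r F = refl

  ColumnsStrict : Filling n → Set
  ColumnsStrict = All (Linked Fin._<_)

  RowsWeak : Filling n → Set
  RowsWeak F = ∀ r → Linked Fin._≤_ (row r F)

  SameRowCounts : Filling n → Filling n → Set
  SameRowCounts F G = ∀ r v → count v (row r F) ≡ count v (row r G)

  topRow-dominates : {F S : Filling n} → Pointwise _↭_ F S → ColumnsStrict S →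
                     Pointwise Fin._≤_ (row 0 S) (row 0 F)
  topRow-dominates [] [] = []
  topRow-dominates {_ ∷ _}      {[] ∷ _}      (c↭[] ∷ F↭S) (_ ∷ S↓)
    rewrite Perm.↭-empty-inv c↭[] = topRow-dominates F↭S S↓
  topRow-dominates {[] ∷ _}     {(_ ∷ _) ∷ _} ([]↭c ∷ _)   _ = ⊥-elim (Perm.¬x∷xs↭[] (↭-sym []↭c))
  topRow-dominates {(b ∷ _) ∷ _} {(a ∷ _) ∷ _} (c↭d ∷ F↭S) (d↑ ∷ S↓) =
    All.lookup (head≤all (Linked.map ℕ.<⇒≤ d↑)) (Perm.∈-resp-↭ c↭d (here refl)) ∷ topRow-dominates F↭S S↓

  dropTopRow-↭ : {F S : Filling n} → Pointwise _↭_ F S → row 0 F ≡ row 0 S →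
                 Pointwise _↭_ (dropTopRow F) (dropTopRow S)
  dropTopRow-↭ [] _ = []
  dropTopRow-↭ {_ ∷ _}      {[] ∷ _}      (c↭[] ∷ F↭S) F₀≡S₀
    rewrite Perm.↭-empty-inv c↭[] = Perm.refl ∷ dropTopRow-↭ F↭S F₀≡S₀
  dropTopRow-↭ {[] ∷ _}     {(_ ∷ _) ∷ _} ([]↭c ∷ _)   _ = ⊥-elim (Perm.¬x∷xs↭[] (↭-sym []↭c))
  dropTopRow-↭ {(_ ∷ _) ∷ _} {(_ ∷ _) ∷ _} (c↭d ∷ F↭S) F₀≡S₀
    with refl , F₀≡S₀′ ← List.∷-injective F₀≡S₀ = Perm.drop-∷ c↭d ∷ dropTopRow-↭ F↭S F₀≡S₀′

  ≡-from-topRow : {F S : Filling n} → Pointwise _↭_ F S → row 0 F ≡ row 0 S →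
                  dropTopRow F ≡ dropTopRow S → F ≡ S
  ≡-from-topRow [] _ _ = refl
  ≡-from-topRow {_ ∷ _}      {[] ∷ _}      (c↭[] ∷ F↭S) F₀≡S₀ F′≡S′
    rewrite Perm.↭-empty-inv c↭[] = cong ([] ∷_) (≡-from-topRow F↭S F₀≡S₀ (List.∷-injectiveʳ F′≡S′))
  ≡-from-topRow {[] ∷ _}     {(_ ∷ _) ∷ _} ([]↭c ∷ _)   _ _ = ⊥-elim (Perm.¬x∷xs↭[] (↭-sym []↭c))
  ≡-from-topRow {(_ ∷ _) ∷ _} {(_ ∷ _) ∷ _} (_ ∷ F↭S) F₀≡S₀ F′≡S′
    with refl , F₀≡S₀′ ← List.∷-injective F₀≡S₀
       | refl , F′≡S′′ ← List.∷-injective F′≡S′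
    = cong (_ ∷_) (≡-from-topRow F↭S F₀≡S₀′ F′≡S′′)

  ≡-from-empty : {F S : Filling n} → Pointwise _↭_ F S → All (λ c → length c ℕ.≤ 0) S → F ≡ S
  ≡-from-empty [] [] = refl
  ≡-from-empty {_ ∷ _} {[] ∷ _} (c↭[] ∷ F↭S) (_ ∷ S≤0)
    rewrite Perm.↭-empty-inv c↭[] = cong ([] ∷_) (≡-from-empty F↭S S≤0)

  dropTopRow-height : {k : ℕ} {S : Filling n} → All (λ c → length c ℕ.≤ suc k) S →
                      All (λ c → length c ℕ.≤ k) (dropTopRow S)
  dropTopRow-height []                      = []
  dropTopRow-height {S = [] ∷ _}    (_ ∷ S≤)     = z≤n ∷ dropTopRow-height S≤
  dropTopRow-height {S = (_ ∷ _) ∷ _} (s≤s c≤ ∷ S≤) = c≤ ∷ dropTopRow-height S≤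

  dropTopRow-ColumnsStrict : {S : Filling n} → ColumnsStrict S → ColumnsStrict (dropTopRow S)
  dropTopRow-ColumnsStrict []                        = []
  dropTopRow-ColumnsStrict {[] ∷ _}      (_ ∷ S↓)    = [] ∷ dropTopRow-ColumnsStrict S↓
  dropTopRow-ColumnsStrict {(_ ∷ _) ∷ _} (c↓ ∷ S↓)   = Linked.tail c↓ ∷ dropTopRow-ColumnsStrict S↓

  dropTopRow-RowsWeak : {F : Filling n} → RowsWeak F → RowsWeak (dropTopRow F)
  dropTopRow-RowsWeak {F} F→ r = subst (Linked Fin._≤_) (sym (row-dropTopRow r F)) (F→ (suc r))

  dropTopRow-SameRowCounts : {F G : Filling n} → SameRowCounts F G →
                             SameRowCounts (dropTopRow F) (dropTopRow G)
  dropTopRow-SameRowCounts {F} {G} FG r v rewrite row-dropTopRow r F | row-dropTopRow r G = FG (suc r) v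

  rowWordUpTo : ℕ → Filling n → List (Fin n)
  rowWordUpTo zero    F = []
  rowWordUpTo (suc k) F = row 0 F ++ rowWordUpTo k (dropTopRow F)

  DominanceUpTo : ℕ → Filling n → Filling n → Filling n → Set
  DominanceUpTo k F S T = (F ≡ S × rowWordUpTo k S ≡ rowWordUpTo k T) ⊎ rowWordUpTo k S <Lex rowWordUpTo k T

  -- Row by row: the top row of F dominates that of S entrywise, hence so does its sorted
  -- rearrangement, the top row of T; if the top rows of S and T agree, so do those of F and S.
  column-rearrangement-dominance :
    (k : ℕ) {F S T : Filling n} → All (λ c → length c ℕ.≤ k) S →
    ColumnsStrict S → RowsWeak S → RowsWeak T → Pointwise _↭_ F S → SameRowCounts F T →
    DominanceUpTo k F S T
  column-rearrangement-dominance zero    S≤0 _ _ _ F↭S _ = inj₁ (≡-from-empty F↭S S≤0 , refl)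
  column-rearrangement-dominance (suc k) {F} {S} {T} S≤k S↓ S→ T→ F↭S FT =
    compareTop (Pointwise-≤⇒≡⊎<Lex S₀≤T₀)
    where
    S₀≤F₀ : Pointwise Fin._≤_ (row 0 S) (row 0 F)
    S₀≤F₀ = topRow-dominates F↭S S↓
    F₀↭T₀ : row 0 F ↭ row 0 T
    F₀↭T₀ = ≡count⇒↭ (row 0 F) (row 0 T) (FT 0)
    S₀≤T₀ : Pointwise Fin._≤_ (row 0 S) (row 0 T)
    S₀≤T₀ = Pointwise-≤-sort (S→ 0) (T→ 0) S₀≤F₀ F₀↭T₀

    compareTop : row 0 S ≡ row 0 T ⊎ row 0 S <Lex row 0 T → DominanceUpTo (suc k) F S T
    compareTop (inj₂ S₀<T₀) = inj₂ (<Lex-++ _ _ (Pointwise-length S₀≤T₀) S₀<T₀)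
    compareTop (inj₁ S₀≡T₀) = compareBelow below
      where
      F₀≡S₀ : row 0 F ≡ row 0 S
      F₀≡S₀ = sym (Pointwise-≤-↭⇒≡ S₀≤F₀ (subst (row 0 F ↭_) (sym S₀≡T₀) F₀↭T₀))
      below : DominanceUpTo k (dropTopRow F) (dropTopRow S) (dropTopRow T)
      below = column-rearrangement-dominance k (dropTopRow-height S≤k) (dropTopRow-ColumnsStrict S↓)
                (dropTopRow-RowsWeak {S} S→) (dropTopRow-RowsWeak {T} T→) (dropTopRow-↭ F↭S F₀≡S₀)
                (dropTopRow-SameRowCounts {F} {T} FT)
      compareBelow : DominanceUpTo k (dropTopRow F) (dropTopRow S) (dropTopRow T) →
                     DominanceUpTo (suc k) F S T
      compareBelow (inj₁ (F′≡S′ , S′≡T′)) = inj₁ (≡-from-topRow F↭S F₀≡S₀ F′≡S′ , cong₂ _++_ S₀≡T₀ S′≡T′)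
      compareBelow (inj₂ S′<T′) =
        inj₂ (subst (λ w → (row 0 S ++ _) <Lex (w ++ _)) S₀≡T₀ (<Lex-prefix (row 0 S) S′<T′))

  rowWordUpTo-applyUpTo : (k : ℕ) (h : ℕ → ℕ) {F G : Filling n} → (∀ r → row (h r) G ≡ row r F) →
                          concatMap (λ r → row r G) (applyUpTo h k) ≡ rowWordUpTo k F
  rowWordUpTo-applyUpTo zero    h         rows = refl
  rowWordUpTo-applyUpTo (suc k) h {F} {G} rows =
    cong₂ _++_ (rows 0) (rowWordUpTo-applyUpTo k (h ∘ suc) {dropTopRow F} {G} λ r →
                           trans (rows (suc r)) (sym (row-dropTopRow r F)))

  rowWord≡rowWordUpTo : (F : Filling n) → rowWord F ≡ rowWordUpTo (height F) F
  rowWord≡rowWordUpTo F = rowWordUpTo-applyUpTo (height F) id {F} {F} λ r → refl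

  length≤height : (F : Filling n) → All (λ c → length c ℕ.≤ height F) F
  length≤height []      = []
  length≤height (c ∷ F) =
    ℕ.m≤m⊔n (length c) (height F) ∷
    All.map (λ c′≤ → ℕ.≤-trans c′≤ (ℕ.m≤n⊔m (length c) (height F))) (length≤height F)

  row-beyond-height : (r : ℕ) (F : Filling n) → height F ℕ.≤ r → row r F ≡ []
  row-beyond-height r F h≤r = go F (All.map (λ c≤ → ℕ.≤-trans c≤ h≤r) (length≤height F))
    where
    getAt-beyond : (c : List (Fin n)) {r : ℕ} → length c ℕ.≤ r → getAt c r ≡ nothing
    getAt-beyond []      _         = refl
    getAt-beyond (_ ∷ c) (s≤s c≤r) = getAt-beyond c c≤r
    go : (G : Filling n) → All (λ c → length c ℕ.≤ r) G → row r G ≡ []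
    go []      []          = refl
    go (c ∷ G) (c≤r ∷ G≤r) rewrite getAt-beyond c c≤r = go G G≤r

  sameRowContent⇒SameRowCounts : (F G : Filling n) → sameRowContent F G ≡ true → SameRowCounts F G
  sameRowContent⇒SameRowCounts F G same r v with r ℕ.<? height F ⊔ height G
  ... | yes r<h =
    ℕ.≡ᵇ⇒≡ _ _ (allB-sound _ (allB-sound _ (Equivalence.from T-≡ same) (∈-upTo⁺ r<h)) (∈-allFin v))
  ... | no  r≮h = cong (count v) (trans (row-beyond-height r F (ℕ.≤-trans (ℕ.m≤m⊔n _ _) h≤r))
                                        (sym (row-beyond-height r G (ℕ.≤-trans (ℕ.m≤n⊔m _ _) h≤r))))
    where h≤r = ℕ.≮⇒≥ r≮h

  sameRowContent-refl : (F : Filling n) → sameRowContent F F ≡ true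
  sameRowContent-refl F = Equivalence.to T-≡
    (allB-complete _ (upTo (height F ⊔ height F)) λ r →
       allB-complete (λ v → count v (row r F) ℕ.≡ᵇ count v (row r F)) (allFin n) λ v →
         ℕ.≡⇒≡ᵇ (count v (row r F)) _ refl)

module _ {n : ℕ} {lam : List ℕ} {z : Vec ℕ n} where

  SSYT-rowWord-dominance : {F S T : Filling n} → SSYT lam z S → SSYT lam z T → Pointwise _↭_ F S →
    sameRowContent F T ≡ true → (F ≡ S × rowWord S ≡ rowWord T) ⊎ rowWord S <Lex rowWord T
  SSYT-rowWord-dominance {F} {S} {T} ((shapeS , _) , S↓ , S→) ((shapeT , _) , _ , T→) F↭S same
    = subst₂ (λ wS wT → (F ≡ S × wS ≡ wT) ⊎ wS <Lex wT) (sym (rowWord≡rowWordUpTo S)) (sym rowWordT)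
        (column-rearrangement-dominance (height S) (length≤height S) S↓ S→ T→ F↭S
          (sameRowContent⇒SameRowCounts F T same))
    where
    rowWordT : rowWord T ≡ rowWordUpTo (height S) T
    rowWordT = trans (rowWord≡rowWordUpTo T)
                     (cong (λ shape → rowWordUpTo (foldr _⊔_ 0 shape) T) (trans shapeT (sym shapeS)))

  R-≺ : {S T : Filling n} → SSYT lam z S → SSYT lam z T → T ≺ S → R S T ≡ ℤ.+ 0
  R-≺ {S} {T} sS sT T≺S =
    cong (λ ps → sumℤ (map proj₁ ps))
         (List.filter-none (λ p → sameRowContent (proj₂ p) T Bool.≟ true)
                           (All.map (λ {p} → excluded {p}) (colPerms-↭ S)))
    where
    excluded : {p : ℤ × Filling n} → Pointwise _↭_ (proj₂ p) S → sameRowContent (proj₂ p) T ≢ true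
    excluded F↭S same with SSYT-rowWord-dominance sS sT F↭S same
    ... | inj₁ (_ , S≡T) = <Lex-irrefl (subst (_<Lex rowWord S) (sym S≡T) T≺S)
    ... | inj₂ S<T       = <Lex-asym T≺S S<T

  R-refl : {S : Filling n} → SSYT lam z S → R S S ≡ ℤ.+ 1
  R-refl {S} sS@(_ , S↓ , _) = begin
      R S S
    ≡⟨ sumℤ-filter (λ p → sameRowContent (proj₂ p) S Bool.≟ true) (colPerms S) ⟩
      sumOf (λ p → select (does (sameRowContent (proj₂ p) S Bool.≟ true)) (proj₁ p)) (colPerms S)
    ≡⟨ sumOf-cong (λ {p} F↭S → cong (λ b → select b (proj₁ p)) (same⇔≡ F↭S (proj₂ p ≟F S))) (colPerms-↭ S) ⟩
      multiplicity _≟F_ (colPerms S) S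
    ≡⟨ multiplicity-colPerms S (All.map strict⇒Unique S↓) ⟩
      ℤ.+ 1 ∎
    where
    open ≡-Reasoning
    strict⇒Unique : {c : List (Fin n)} → Linked Fin._<_ c → Unique c
    strict⇒Unique c↓ = AllPairs.map Fin.<⇒≢ (Linkedₚ.Linked⇒AllPairs Fin.<-trans c↓)
    same⇔≡ : {F : Filling n} → Pointwise _↭_ F S → Dec (F ≡ S) →
             does (sameRowContent F S Bool.≟ true) ≡ does (F ≟F S)
    same⇔≡ {F} F↭S (yes refl) rewrite sameRowContent-refl S | dec-true (S ≟F S) refl = refl
    same⇔≡ {F} F↭S (no F≢S) rewrite dec-false (F ≟F S) F≢S with sameRowContent F S Bool.≟ true
    ... | no _     = refl
    ... | yes same with SSYT-rowWord-dominance sS sS F↭S same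
    ...   | inj₁ (F≡S , _) = ⊥-elim (F≢S F≡S)
    ...   | inj₂ S<S       = ⊥-elim (<Lex-irrefl S<S)

AllPairs-lookup-drop : {R : A → A → Set} {xs : List A} → AllPairs R xs → (i : Fin (length xs)) →
                       All (R (lookup xs i)) (drop (suc (toℕ i)) xs)
AllPairs-lookup-drop (Rx ∷ _)  Fin.zero    = Rx
AllPairs-lookup-drop (_ ∷ Rxs) (Fin.suc i) = AllPairs-lookup-drop Rxs i

module _ {n : ℕ} where

  sumV-++ : (us vs : List (Vect n)) (G : Filling n) → sumV (us ++ vs) G ≡ sumV us G ℚ.+ sumV vs G
  sumV-++ []       vs G = sym (ℚ.+-identityˡ _)
  sumV-++ (u ∷ us) vs G = trans (cong (λ q → u G ℚ.+ q) (sumV-++ us vs G)) (sym (ℚ.+-assoc (u G) _ _))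

  Rsum : Filling n → List (Filling n × Vect n) → Vect n
  Rsum S acc = sumV (map (λ p → fromℤ (R S (proj₁ p)) ·v proj₂ p) acc)

  RsumZip : Filling n → List (Filling n) → List (Vect n) → Vect n
  RsumZip S Ts ds = sumV (zipWith (λ T d → fromℤ (R S T) ·v d) Ts ds)

  RsumZip-zero : (S : Filling n) {Ts : List (Filling n)} (ds : List (Vect n)) →
                      All (λ T → R S T ≡ ℤ.+ 0) Ts → (G : Filling n) → RsumZip S Ts ds G ≡ 0ℚ
  RsumZip-zero S {[]}    _        []            G = refl
  RsumZip-zero S {_ ∷ _} []       _             G = refl
  RsumZip-zero S (d ∷ ds) (R≡0 ∷ R≡0s) G rewrite R≡0 | RsumZip-zero S ds R≡0s G =
    trans (ℚ.+-identityʳ _) (ℚ.*-zeroˡ (d G))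

  -- acc holds the pairs (S_j , D(S_j)) already produced, and the next one is D(S) = S − Rsum S acc.
  Dgo-expansion : (acc : List (Filling n × Vect n)) (Ss : List (Filling n)) (i : Fin (length Ss)) →
    R (lookup Ss i) (lookup Ss i) ≡ ℤ.+ 1 → All (λ T → R (lookup Ss i) T ≡ ℤ.+ 0) (drop (suc (toℕ i)) Ss) →
    (G : Filling n) → Rsum (lookup Ss i) acc G ℚ.+ RsumZip (lookup Ss i) Ss (Dgo acc Ss) G ≡ δ (lookup Ss i) G
  Dgo-expansion acc (S ∷ Ss) Fin.zero R≡1 R≡0s G
    rewrite R≡1 | RsumZip-zero S (Dgo (acc ++ [ (S , δ S -v Rsum S acc) ]) Ss) R≡0s G =
    solve 2 (λ a d → a :+ (con 1ℚ :* (d :- a) :+ con 0ℚ) := d) refl (Rsum S acc G) (δ S G)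
    where open +-*-Solver
  Dgo-expansion acc (S′ ∷ Ss) (Fin.suc i) R≡1 R≡0s G = begin
      Rsum S acc G ℚ.+ (x ℚ.+ rest)
    ≡⟨ solve 3 (λ a x r → a :+ (x :+ r) := (a :+ (x :+ con 0ℚ)) :+ r) refl (Rsum S acc G) x rest ⟩
      (Rsum S acc G ℚ.+ (x ℚ.+ 0ℚ)) ℚ.+ rest
    ≡⟨ cong (λ q → q ℚ.+ rest) (sym (trans (cong (λ vs → sumV vs G) (List.map-++ _ acc [ (S′ , d) ]))
                                   (sumV-++ (map _ acc) _ G))) ⟩
      Rsum S (acc ++ [ (S′ , d) ]) G ℚ.+ rest
    ≡⟨ Dgo-expansion (acc ++ [ (S′ , d) ]) Ss i R≡1 R≡0s G ⟩
      δ S G ∎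
    where
    open ≡-Reasoning
    open +-*-Solver
    S = lookup Ss i
    d = δ S′ -v Rsum S′ acc
    x = (fromℤ (R S S′) ·v d) G
    rest = RsumZip S Ss (Dgo (acc ++ [ (S′ , d) ]) Ss) G

  Dlist-expansion : (Ss : List (Filling n)) (i : Fin (length Ss)) →
    R (lookup Ss i) (lookup Ss i) ≡ ℤ.+ 1 → All (λ T → R (lookup Ss i) T ≡ ℤ.+ 0) (drop (suc (toℕ i)) Ss) →
    (G : Filling n) → RsumZip (lookup Ss i) Ss (Dlist Ss) G ≡ δ (lookup Ss i) G
  Dlist-expansion Ss i R≡1 R≡0s G = trans (sym (ℚ.+-identityˡ _)) (Dgo-expansion [] Ss i R≡1 R≡0s G)

  InAλz-zero : {lam : List ℕ} {z : Vec ℕ n} {v : Vect n} → (∀ G → v G ≡ 0ℚ) → InAλz lam z v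
  InAλz-zero v≡0 = ([] , [] , v≡0) , λ G v≢0 → ⊥-elim (v≢0 (v≡0 G))

lemma4p1 : (n : ℕ) → 2 ≤ n →
    (lam : List ℕ) → IsPartition lam → length lam ≤ n →
    (z : Vec ℕ n) → Data.Vec.sum z ≡ size lam →
    (Ss : List (Filling n)) →
    Linked (λ a b → b ≺ a) Ss →
    All (SSYT lam z) Ss →
    (∀ T → SSYT lam z T → T ∈ Ss) →
    (i : Fin (length Ss)) →
    InAλz lam z
      (δ (lookup Ss i) -v
        sumV (zipWith (λ S d → fromℤ (R (lookup Ss i) S) ·v d) Ss (Dlist Ss)))
lemma4p1 n _ lam _ _ z _ Ss descending tableaux _ i = InAλz-zero {lam = lam} {z = z} λ G → begin
    δ S G ℚ.- RsumZip S Ss (Dlist Ss) G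
  ≡⟨ cong (λ q → δ S G ℚ.- q) (Dlist-expansion Ss i R[S,S]≡1 R[S,later]≡0 G) ⟩
    δ S G ℚ.- δ S G
  ≡⟨ ℚ.+-inverseʳ (δ S G) ⟩
    0ℚ ∎
  where
  open ≡-Reasoning
  S : Filling n
  S = lookup Ss i
  S-SSYT : SSYT lam z S
  S-SSYT = All.lookup tableaux (∈-lookup i)
  R[S,S]≡1 : R S S ≡ ℤ.+ 1
  R[S,S]≡1 = R-refl {lam = lam} {z = z} S-SSYT
  later≺S : All (_≺ S) (drop (suc (toℕ i)) Ss)
  later≺S = AllPairs-lookup-drop (Linkedₚ.Linked⇒AllPairs (λ b≺a c≺b → <Lex-trans c≺b b≺a) descending) i
  R[S,later]≡0 : All (λ T → R S T ≡ ℤ.+ 0) (drop (suc (toℕ i)) Ss)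
  R[S,later]≡0 = All.zipWith (λ (T≺S , T-SSYT) → R-≺ {lam = lam} {z = z} S-SSYT T-SSYT T≺S)
                             (later≺S , All.drop⁺ (suc (toℕ i)) tableaux)
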